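{- Let $G$ be a connected graph. Let $T(G,c^*)$ and $T(G,c)$ be Tseitin-formulas where $T(G,c^*)$ is satisfiable and $T(G,c)$ is unsatisfiable. For every well-structured read-once branching program (1-BP) $B$ computing $\textup{SearchVertex}(G,c)$ there exists a DNNF of size $O(|B| \times |V(G)|)$ computing $T(G,c^*)$.
   Context: For a graph $G=(V,E)$ and a charge function $c:V\to\{0,1\}$, the Tseitin-formula $T(G,c)$ has a Boolean variable $x_e$ for each edge $e$ and is the conjunction over all $v\in V$ of the parity constraints $\chi_v:\sum_{e\in E(v)} x_e = c(v) \bmod 2$, where $E(v)$ is the set of edges incident to $v$. For unsatisfiable $T(G,c)$, the relation $\textup{SearchVertex}(G,c)$ consists of the pairs $(a,v)$ such that the assignment $a$ violates $\chi_v$; a branching program $B$ computes this relation if $(a,B(a))$ is in it for every assignment $a$. A 1-BP is a branching program in which every variable appears at most once on every path. $1_v$ denotes the charge function that is $1$ on $v$ and $0$ elsewhere. For a node $u_k$ computing $\textup{SearchVertex}(G_k,c_k)$ with $G_k$ connected and a decision on $x_e$, $e=ab$: $\gamma_k(x_e)=c_k+1_a+1_b \bmod 2$, $\gamma_k(\overline{x_e})=c_k$; $G^a_k$ and $G^b_k$ are the connected components of $G_k-e$ containing $a$ and $b$ (equal if $e$ is not a bridge), and $\gamma^a_k(\ell),\gamma^b_k(\ell)$ are the restrictions of $\gamma_k(\ell)$ to their vertices. A branching program $B$ computing $\textup{SearchVertex}(G,c)$ (with $T(G,c)$ unsatisfiable, $G$ connected) is well-structured if every node $u_k$ has a connected subgraph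 $G_k$ of $G$ and charge function $c_k$ with $T(G_k,c_k)$ unsatisfiable such that $u_k$ computes $\textup{SearchVertex}(G_k,c_k)$, and: (1) for the source, $G_k=G$, $c_k=c$; (2) for a sink corresponding to $v$, $G_k=(\{v\},\emptyset)$, $c_k=1_v$; (3) for a decision node on $x_{ab}$ with 0- and 1-successors $u_{k_0},u_{k_1}$, letting $\ell_0=\overline{x_{ab}}$, $\ell_1=x_{ab}$, for each $i\in\{0,1\}$, $(G_{k_i},c_{k_i})=(G^a_k,\gamma^a_k(\ell_i))$ if $T(G^a_k,\gamma^a_k(\ell_i))$ is unsatisfiable and $(G^b_k,\gamma^b_k(\ell_i))$ otherwise. A DNNF is a circuit in negation normal form (inputs are literals or constants, internal nodes binary $\land$/$\lor$ gates) in which every $\land$-gate has children on disjoint variable sets; its size is its number of gates. -}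

module Defs where

open import Data.Nat using (ℕ; zero; suc; _<_; _≤_; _*_)
open import Data.Fin using (Fin; toℕ; _≟_)
open import Data.Bool using (Bool; true; false; not; _xor_; _∧_; _∨_; if_then_else_)
open import Data.List using (List; []; _∷_; allFin)
open import Data.Product using (Σ; ∃; _×_; _,_; proj₁; proj₂)
open import Data.Sum using (_⊎_)
open import Data.Empty using (⊥)
open import Data.Unit using (⊤)
open import Relation.Nullary using (¬_)
open import Relation.Nullary.Decidable using (⌊_⌋)
open import Relation.Binary.PropositionalEquality using (_≡_; _≢_)
open import Function.Bundles using (_⇔_)

record Graph (n m : ℕ) : Set where
  field
    ends     : Fin m → Fin n × Fin n
    loopless : ∀ e → proj₁ (ends e) ≢ proj₂ (ends e)
    simple   : ∀ e f → proj₁ (ends e) ≡ proj₁ (ends f) ⊎ proj₁ (ends e) ≡ proj₂ (ends f) →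
                       proj₂ (ends e) ≡ proj₁ (ends f) ⊎ proj₂ (ends e) ≡ proj₂ (ends f) →
                       e ≡ f
open Graph public

module _ {n m : ℕ} (G : Graph n m) where

  Inc : Fin m → Fin n → Set
  Inc e v = proj₁ (ends G e) ≡ v ⊎ proj₂ (ends G e) ≡ v

  record Sub : Set₁ where
    field
      vert   : Fin n → Set
      edge   : Fin m → Set
      closed : ∀ e → edge e → vert (proj₁ (ends G e)) × vert (proj₂ (ends G e))
  open Sub public

  fullSub : Sub
  fullSub = record { vert = λ _ → ⊤ ; edge = λ _ → ⊤ ; closed = λ _ _ → _ , _ }

  SameSub : Sub → Sub → Set
  SameSub S T = (∀ v → vert S v ⇔ vert T v) × (∀ e → edge S e ⇔ edge T e)

  data Walk (S : Sub) : Fin n → Fin n → Set where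
    here : ∀ {v} → vert S v → Walk S v v
    step : ∀ {v w} e → edge S e →
           (proj₁ (ends G e) ≡ v × proj₂ (ends G e) ≡ w) ⊎
           (proj₂ (ends G e) ≡ v × proj₁ (ends G e) ≡ w) →
           ∀ {u} → Walk S w u → Walk S v u

  Connected : Sub → Set
  Connected S = ∀ v w → vert S v → vert S w → Walk S v w

  Assignment : Set
  Assignment = Fin m → Bool

  Charge : Set
  Charge = Fin n → Bool

  data ParityL (S : Sub) (a : Assignment) (v : Fin n) : List (Fin m) → Bool → Set where
    nil  : ParityL S a v [] false
    cnt  : ∀ {e es b} → edge S e → Inc e v → a e ≡ true →
           ParityL S a v es b → ParityL S a v (e ∷ es) (not b)
    skip : ∀ {e es b} → ¬ (edge S e × Inc e v × a e ≡ true) →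
           ParityL S a v es b → ParityL S a v (e ∷ es) b

  Chi : Sub → Charge → Assignment → Fin n → Set
  Chi S c a v = ParityL S a v (allFin m) (c v)

  Satisfies : Sub → Charge → Assignment → Set
  Satisfies S c a = ∀ v → vert S v → Chi S c a v

  Satisfiable : Sub → Charge → Set
  Satisfiable S c = ∃ λ a → Satisfies S c a

  Unsat : Sub → Charge → Set
  Unsat S c = ¬ Satisfiable S c

  SearchVertex : Sub → Charge → Assignment → Fin n → Set
  SearchVertex S c a v = vert S v × ¬ Chi S c a v

  minusEdge : Sub → Fin m → Sub
  minusEdge S e = record
    { vert = vert S ; edge = λ f → edge S f × f ≢ e
    ; closed = λ f p → closed S f (proj₁ p) }

  CompV : Sub → Fin m → Fin n → Fin n → Set
  CompV S e x w = Walk (minusEdge S e) x w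

  comp : Sub → Fin m → Fin n → Sub
  comp S e x = record
    { vert = CompV S e x
    ; edge = λ f → (edge S f × f ≢ e) × CompV S e x (proj₁ (ends G f)) × CompV S e x (proj₂ (ends G f))
    ; closed = λ f p → proj₁ (proj₂ p) , proj₂ (proj₂ p) }

  -- charges agree on the vertices of S (a charge function of a subgraph
  -- is only meaningful on its vertices)
  AgreeOn : Sub → Charge → Charge → Set
  AgreeOn S c d = ∀ v → vert S v → c v ≡ d v

  gamma : Charge → Fin m → Bool → Charge
  gamma c e false w = c w
  gamma c e true  w = (c w xor ⌊ w ≟ proj₁ (ends G e) ⌋) xor ⌊ w ≟ proj₂ (ends G e) ⌋

-- Branching programs with s nodes (node zero is the source), sinks
-- labelled by vertices, decisions on edge variables.  Nodes are
-- topologically ordered (successors have larger index), so B is a DAG.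

data BPNode (n m s : ℕ) : Set where
  sink : Fin n → BPNode n m s
  dec  : Fin m → Fin s → Fin s → BPNode n m s   -- variable, 0-successor, 1-successor

record BP (n m s : ℕ) : Set where
  field
    node    : Fin s → BPNode n m s
    ordered : ∀ k e k₀ k₁ → node k ≡ dec e k₀ k₁ → toℕ k < toℕ k₀ × toℕ k < toℕ k₁
open BP public

module _ {n m s : ℕ} (B : BP n m s) where

  data Run (a : Fin m → Bool) : Fin s → Fin n → Set where
    atSink : ∀ {k v} → node B k ≡ sink v → Run a k v
    atDec  : ∀ {k e k₀ k₁ v} → node B k ≡ dec e k₀ k₁ →
             Run a (if a e then k₁ else k₀) v → Run a k v

  Step : Fin s → Fin s → Set
  Step k k′ = ∃ λ e → ∃ λ k₀ → ∃ λ k₁ → node B k ≡ dec e k₀ k₁ × (k′ ≡ k₀ ⊎ k′ ≡ k₁)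

  data Reach : Fin s → Fin s → Set where
    refl′ : ∀ {k} → Reach k k
    _◅_   : ∀ {k k′ k″} → Step k k′ → Reach k′ k″ → Reach k k″

  ReadOnce : Set
  ReadOnce = ∀ k k′ e e′ k₀ k₁ k₀′ k₁′ →
             node B k ≡ dec e k₀ k₁ → node B k′ ≡ dec e′ k₀′ k₁′ →
             (∃ λ k″ → Step k k″ × Reach k″ k′) → e ≢ e′

module _ {n m s : ℕ} (G : Graph n m) (B : BP n m s) where

  ComputesAt : Fin s → Sub G → Charge G → Set
  ComputesAt k S c = ∀ a v → Run B a k v → SearchVertex G S c a v

  -- condition (3) for the ℓ-successor k′ (ℓ = false: ¬x_e, ℓ = true: x_e)
  SuccOK : Sub G → Charge G → Fin m → Bool → Sub G → Charge G → Set
  SuccOK S c e ℓ S′ c′ =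
      (Unsat G Ga γ × SameSub G S′ Ga × AgreeOn G Ga c′ γ)
    ⊎ (¬ Unsat G Ga γ × SameSub G S′ Gb × AgreeOn G Gb c′ γ)
    where
      Ga = comp G S e (proj₁ (ends G e))
      Gb = comp G S e (proj₂ (ends G e))
      γ  = gamma G c e ℓ

  record WellStructured (c : Charge G) (src : Fin s) : Set₁ where
    field
      sub    : Fin s → Sub G
      chg    : Fin s → Charge G
      conn   : ∀ k → Connected G (sub k)
      unsat  : ∀ k → Unsat G (sub k) (chg k)
      comput : ∀ k → ComputesAt k (sub k) (chg k)
      source : SameSub G (sub src) (fullSub G) × AgreeOn G (fullSub G) (chg src) c
      sinks  : ∀ k v → node B k ≡ sink v →
               SameSub G (sub k) (record { vert = λ w → w ≡ v ; edge = λ _ → ⊥ ; closed = λ _ () })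
               × chg k v ≡ true
      decs   : ∀ k e k₀ k₁ → node B k ≡ dec e k₀ k₁ →
               SuccOK (sub k) (chg k) e false (sub k₀) (chg k₀)
               × SuccOK (sub k) (chg k) e true (sub k₁) (chg k₁)

-- Circuits in NNF as DAGs.  Gates are added one at a time; a wire of a
-- circuit with g gates is a literal, a constant, or a gate (de Bruijn
-- index: gate zero is the most recently added one).

data Wire (m g : ℕ) : Set where
  lit   : Fin m → Bool → Wire m g       -- lit x true = x, lit x false = ¬x
  const : Bool → Wire m g
  gate  : Fin g → Wire m g

data Gate (m g : ℕ) : Set where
  and or : Wire m g → Wire m g → Gate m g

data Circuit (m : ℕ) : ℕ → Set where
  []  : Circuit m 0
  _▷_ : ∀ {g} → Circuit m g → Gate m g → Circuit m (suc g)

mutual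
  evalW : ∀ {m g} → Circuit m g → (Fin m → Bool) → Wire m g → Bool
  evalW C a (lit x true)  = a x
  evalW C a (lit x false) = not (a x)
  evalW C a (const b)     = b
  evalW C a (gate i)      = evalG C a i

  evalG : ∀ {m g} → Circuit m g → (Fin m → Bool) → Fin g → Bool
  evalG (C ▷ and w₁ w₂) a Fin.zero = evalW C a w₁ ∧ evalW C a w₂
  evalG (C ▷ or w₁ w₂)  a Fin.zero = evalW C a w₁ ∨ evalW C a w₂
  evalG (C ▷ _) a (Fin.suc i) = evalG C a i

mutual
  VarsW : ∀ {m g} → Circuit m g → Wire m g → Fin m → Set
  VarsW C (lit x _) y = x ≡ y
  VarsW C (const _) y = ⊥
  VarsW C (gate i)  y = VarsG C i y

  VarsG : ∀ {m g} → Circuit m g → Fin g → Fin m → Set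
  VarsG (C ▷ and w₁ w₂) Fin.zero y = VarsW C w₁ y ⊎ VarsW C w₂ y
  VarsG (C ▷ or  w₁ w₂) Fin.zero y = VarsW C w₁ y ⊎ VarsW C w₂ y
  VarsG (C ▷ _) (Fin.suc i) y = VarsG C i y

Decomposable : ∀ {m g} → Circuit m g → Set
Decomposable [] = ⊤
Decomposable (C ▷ and w₁ w₂) = Decomposable C × (∀ y → VarsW C w₁ y → VarsW C w₂ y → ⊥)
Decomposable (C ▷ or  w₁ w₂) = Decomposable C

record DNNF (m : ℕ) : Set where
  field
    size    : ℕ
    circuit : Circuit m size
    output  : Wire m size
    decomp  : Decomposable circuit
open DNNF public

evalD : ∀ {m} → DNNF m → (Fin m → Bool) → Bool
evalD D a = evalW (circuit D) a (output D)

ComputesT : ∀ {n m} → DNNF m → (G : Graph n m) → Charge G → Set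
ComputesT D G c = ∀ a → (evalD D a ≡ true) ⇔ Satisfies G (fullSub G) c a

{-# OPTIONS --safe #-}
-- For every node k of B and vertex w we build a DNNF wire computing T(G_k, c_k + 1_w). At a sink v
-- this is the constant [w = v]. At a decision on x_e, e = ab, fixing x_e splits T(G_k, c_k + 1_w)
-- into the formulas of the components of G_k - e, charged with γ_k(x_e) + 1_w. If e is not a bridge
-- this is the formula of the selected successor. If it is a bridge, the selected side is
-- unsatisfiable with γ_k(x_e) alone, so it must absorb 1_w, and the other side is the formula of the
-- other successor with its own end of e charged; here the parity fact is used that on a connected
-- graph T(H, d) and T(H, d + 1_u) are never both unsatisfiable. The two sides have disjoint edge
-- sets, which makes the ∧-gates decomposable, and each pair (k, w) costs five gates. At the source
-- T(G, c + 1_w) is satisfiable for some w, and T(G, c*) is a translate of it, obtained by flipping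
-- literals.
module Submission where

open import Defs
open import Data.Nat using (ℕ; suc; _≤_; _*_)
open import Data.Fin using (Fin; zero)
open import Data.Product using (Σ; ∃; _×_)

open import Algebra.Bundles using (CommutativeRing)
open import Data.Bool using (Bool; true; false; not; _xor_; _∧_; _∨_; if_then_else_)
import Data.Bool as Bool
open import Data.Bool.Properties
  using (¬-not; not-involutive; ∧-conicalˡ; ∧-zeroʳ; ∧-identityʳ; ∨-zeroʳ; ∨-identityʳ; ∧-distribˡ-xor;
         xor-assoc; xor-comm; xor-identityʳ; xor-same; xor-∧-commutativeRing)
open import Data.Empty using (⊥; ⊥-elim)
open import Data.Fin using (_≟_; _<_; _>_; toℕ; fromℕ<; punchIn)
open import Data.Fin.Induction using (>-wellFounded)
open import Data.Fin.Properties using (punchInᵢ≢i; toℕ<n; toℕ-fromℕ<; toℕ-injective)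
open import Data.List using (List; []; _∷_; allFin; tabulate; length)
open import Data.List.Membership.Propositional using (_∈_; _∉_)
open import Data.List.Membership.Propositional.Properties using (∈-allFin)
open import Data.List.Properties using (length-tabulate)
open import Data.List.Relation.Unary.Any using (here; there)
open import Data.Maybe using (Maybe; just; nothing)
import Data.Nat as ℕ
open import Data.Nat using (_+_; z≤n; s≤s)
open import Data.Nat.Properties
  using (≤-refl; ≤-trans; ≤-reflexive; m≤n+m; m<m+n; <⇒≱; m≤n⇒m<n∨m≡n;
         +-monoʳ-≤; +-assoc; +-identityʳ; +-suc; *-comm; *-assoc)
open import Data.Product using (_,_; proj₁; proj₂; map₂)
open import Data.Product.Function.NonDependent.Propositional using (_×-⇔_)
open import Data.Sum using (_⊎_; inj₁; inj₂; [_,_]′)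
open import Data.Unit using (⊤)
open import Effect.Monad using (RawMonad)
open import Function using (_∘_)
open import Function.Bundles using (_⇔_; mk⇔; Equivalence)
import Function.Properties.Equivalence as ⇔
open import Induction.WellFounded using (Acc; acc)
open import Level using (0ℓ)
open import Relation.Binary.PropositionalEquality
  using (_≡_; _≢_; refl; sym; trans; cong; cong₂; subst; _≗_; module ≡-Reasoning)
open import Relation.Nullary using (¬_; yes; no; does)
open import Relation.Nullary.Decidable
  using (⌊_⌋; isYes≗does; dec-true; dec-false; does-⇔; decidable-stable; ¬¬-excluded-middle)
open import Relation.Nullary.Negation using (DoubleNegation; Stable; negated-stable; ¬¬-Monad; ¬¬-map)
open import Relation.Unary using (Decidable)

open CommutativeRing xor-∧-commutativeRing using (+-commutativeMonoid; +-commutativeSemigroup)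
open import Algebra.Properties.CommutativeMonoid.Sum +-commutativeMonoid
  using (sum; sum-cong-≗; ∑-distrib-+; sum-remove; sum-replicate-zero)
open import Algebra.Properties.CommutativeSemigroup +-commutativeSemigroup
  using () renaming (xy∙z≈xz∙y to xor-swapʳ)
open RawMonad (¬¬-Monad {0ℓ}) using (_>>=_; pure)

infixl 6 _⊕_

_⊕_ : {A : Set} → (A → Bool) → (A → Bool) → A → Bool
(f ⊕ g) x = f x xor g x

𝟙 : ∀ {k} → Fin k → Fin k → Bool
𝟙 u v = ⌊ v ≟ u ⌋

𝟙-self : ∀ {k} (u : Fin k) → 𝟙 u u ≡ true
𝟙-self u = trans (isYes≗does (u ≟ u)) (dec-true (u ≟ u) refl)

𝟙-other : ∀ {k} {u v : Fin k} → v ≢ u → 𝟙 u v ≡ false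
𝟙-other {u = u} {v} v≢u = trans (isYes≗does (v ≟ u)) (dec-false (v ≟ u) v≢u)

×-⇔-dep : ∀ {A A′ B B′ : Set} → A ⇔ A′ → (A → B ⇔ B′) → (A × B) ⇔ (A′ × B′)
×-⇔-dep A⇔A′ B⇔B′ = mk⇔ (λ (p , q) → Equivalence.to A⇔A′ p , Equivalence.to (B⇔B′ p) q)
                         (λ (p , q) → let p′ = Equivalence.from A⇔A′ p in p′ , Equivalence.from (B⇔B′ p′) q)

stable-× : ∀ {A B : Set} → Stable A → Stable B → Stable (A × B)
stable-× stA stB ¬¬ab = stA (¬¬-map proj₁ ¬¬ab) , stB (¬¬-map proj₂ ¬¬ab)

¬¬-⇔ : ∀ {P A B : Set} → Stable A → Stable B → ¬ ¬ P → (P → A ⇔ B) → A ⇔ B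
¬¬-⇔ stA stB ¬¬p A⇔B = mk⇔ (λ x → stB (¬¬-map (λ p → Equivalence.to (A⇔B p) x) ¬¬p))
                            (λ y → stA (¬¬-map (λ p → Equivalence.from (A⇔B p) y) ¬¬p))

≡-true⇔ : ∀ {x y} → x ≡ y → (x ≡ true) ⇔ (y ≡ true)
≡-true⇔ x≡y = mk⇔ (trans (sym x≡y)) (trans x≡y)

∧-true⇔ : ∀ {x y} → (x ∧ y ≡ true) ⇔ (x ≡ true × y ≡ true)
∧-true⇔ {true}  = mk⇔ (refl ,_) proj₂
∧-true⇔ {false} = mk⇔ (λ ()) (λ ())

false≢true : false ≢ true
false≢true ()

¬¬-decidable : ∀ {k} (P : Fin k → Set) → DoubleNegation (Decidable P)
¬¬-decidable {0}     P ¬dec = ¬dec (λ ())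
¬¬-decidable {suc k} P ¬dec = ¬¬-excluded-middle λ P0? → ¬¬-decidable (P ∘ Fin.suc) λ Ps? →
  ¬dec λ { zero → P0? ; (Fin.suc i) → Ps? i }

∧-cong-if : ∀ {p q} x → (x ≡ true → p ≡ q) → p ∧ x ≡ q ∧ x
∧-cong-if {p} {q} false _   = trans (∧-zeroʳ p) (sym (∧-zeroʳ q))
∧-cong-if         true  p≡q = cong (_∧ true) (p≡q refl)

xor-telescope : ∀ x y z → (x xor y) xor (y xor z) ≡ x xor z
xor-telescope x y z = begin
  (x xor y) xor (y xor z)  ≡⟨ xor-assoc x y (y xor z) ⟩
  x xor (y xor (y xor z))  ≡⟨ cong (x xor_) (sym (xor-assoc y y z)) ⟩
  x xor ((y xor y) xor z)  ≡⟨ cong (λ u → x xor (u xor z)) (xor-same y) ⟩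
  x xor z                  ∎
  where open ≡-Reasoning

xor-cancelʳ : ∀ x y → (x xor y) xor y ≡ x
xor-cancelʳ x y = trans (xor-assoc x y y) (trans (cong (x xor_) (xor-same y)) (xor-identityʳ x))

sum-single : ∀ {k} (f : Fin k → Bool) (j : Fin k) → (∀ i → i ≢ j → f i ≡ false) → sum f ≡ f j
sum-single {suc k} f j off = begin
  sum f                          ≡⟨ sum-remove {i = j} f ⟩
  f j xor sum (f ∘ punchIn j)    ≡⟨ cong (f j xor_) (sum-cong-≗ (λ i → off (punchIn j i) (punchInᵢ≢i j i))) ⟩
  f j xor sum {k} (λ _ → false)  ≡⟨ cong (f j xor_) (sum-replicate-zero k) ⟩
  f j xor false                  ≡⟨ xor-identityʳ (f j) ⟩
  f j                            ∎
  where open ≡-Reasoning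

module _ {n m : ℕ} (G : Graph n m) where

  end₁ end₂ : Fin m → Fin n
  end₁ e = proj₁ (ends G e)
  end₂ e = proj₂ (ends G e)

  Joins : Fin m → Fin n → Fin n → Set
  Joins e v w = (end₁ e ≡ v × end₂ e ≡ w) ⊎ (end₂ e ≡ v × end₁ e ≡ w)

  Joins-sym : ∀ {e v w} → Joins e v w → Joins e w v
  Joins-sym (inj₁ (p , q)) = inj₂ (q , p)
  Joins-sym (inj₂ (p , q)) = inj₁ (q , p)

  incidence : Fin m → Charge G
  incidence e = 𝟙 (end₁ e) ⊕ 𝟙 (end₂ e)

  incidence-Joins : ∀ {e v w} → Joins e v w → incidence e ≗ 𝟙 v ⊕ 𝟙 w
  incidence-Joins (inj₁ (refl , refl)) u = refl
  incidence-Joins (inj₂ (refl , refl)) u = xor-comm (𝟙 _ u) (𝟙 _ u)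

  Inc⇒incidence : ∀ {e v} → Inc G e v → incidence e v ≡ true
  Inc⇒incidence {e} (inj₁ refl) =
    cong₂ _xor_ (𝟙-self (end₁ e)) (𝟙-other (loopless G e))
  Inc⇒incidence {e} (inj₂ refl) =
    cong₂ _xor_ (𝟙-other (loopless G e ∘ sym)) (𝟙-self (end₂ e))

  incidence⇒Inc : ∀ {e v} → incidence e v ≡ true → Inc G e v
  incidence⇒Inc {e} {v} eq with v ≟ end₁ e | v ≟ end₂ e
  ... | yes p | _     = inj₁ (sym p)
  ... | no _  | yes q = inj₂ (sym q)
  ... | no _  | no _  = ⊥-elim (false≢true eq)

  Joins-left∈ : ∀ {S : Sub G} {e v w} → edge S e → Joins e v w → vert S v
  Joins-left∈ {S} {e} p (inj₁ (refl , _)) = proj₁ (closed S e p)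
  Joins-left∈ {S} {e} p (inj₂ (refl , _)) = proj₂ (closed S e p)

  walk-head∈ : ∀ {S u w} → Walk G S u w → vert S u
  walk-head∈ (here p)           = p
  walk-head∈ {S} (step e p o W) = Joins-left∈ {S} p o

  walk-last∈ : ∀ {S u w} → Walk G S u w → vert S w
  walk-last∈ (here p)       = p
  walk-last∈ (step e p o W) = walk-last∈ W

  infixr 5 _++ʷ_

  _++ʷ_ : ∀ {S u v w} → Walk G S u v → Walk G S v w → Walk G S u w
  here _       ++ʷ W = W
  step e p o V ++ʷ W = step e p o (V ++ʷ W)

  reverseʷ : ∀ {S u w} → Walk G S u w → Walk G S w u
  reverseʷ (here p)         = here p
  reverseʷ W@(step e p o V) = reverseʷ V ++ʷ step e p (Joins-sym o) (here (walk-head∈ W))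

  mapʷ : ∀ {S T : Sub G} → (∀ v → vert S v → vert T v) → (∀ e → edge S e → edge T e) →
         ∀ {u w} → Walk G S u w → Walk G T u w
  mapʷ fv fe (here p)       = here (fv _ p)
  mapʷ fv fe (step e p o W) = step e (fe e p) o (mapʷ fv fe W)

  -- Connected components of G_k - e

  module _ (S : Sub G) (e : Fin m) where

    private
      S−e = minusEdge G S e

    comp⊆ : ∀ {x v} → vert (comp G S e x) v → vert S v
    comp⊆ = walk-last∈

    comp-incident : ∀ {x v f} → vert (comp G S e x) v → edge S f → f ≢ e → Inc G f v →
                    edge (comp G S e x) f
    comp-incident {f = f} P p f≢e (inj₁ refl) =
      (p , f≢e) , P , P ++ʷ step f (p , f≢e) (inj₁ (refl , refl)) (here (proj₂ (closed S f p)))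
    comp-incident {f = f} P p f≢e (inj₂ refl) =
      (p , f≢e) , P ++ʷ step f (p , f≢e) (inj₂ (refl , refl)) (here (proj₁ (closed S f p))) , P

    walk→comp : ∀ {x u v} → Walk G S−e x u → Walk G S−e u v → Walk G (comp G S e x) u v
    walk→comp P (here _) = here P
    walk→comp P (step f p o@(inj₁ (refl , refl)) W) = step f (p , P , P′) o (walk→comp P′ W)
      where P′ = P ++ʷ step f p o (here (walk-head∈ W))
    walk→comp P (step f p o@(inj₂ (refl , refl)) W) = step f (p , P′ , P) o (walk→comp P′ W)
      where P′ = P ++ʷ step f p o (here (walk-head∈ W))

    comp-connected : ∀ x → Connected G (comp G S e x)
    comp-connected x v w P Q = reverseʷ (walk→comp (here (walk-head∈ P)) P) ++ʷ walk→comp (here (walk-head∈ Q)) Q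

    last-crossing : ∀ {u v} → Walk G S u v →
                    Walk G S−e u v ⊎ (Walk G S−e (end₁ e) v ⊎ Walk G S−e (end₂ e) v)
    last-crossing (here p) = inj₁ (here p)
    last-crossing (step f p o W) with last-crossing W | f ≟ e
    ... | inj₂ V | _      = inj₂ V
    ... | inj₁ V | no f≢e = inj₁ (step f (p , f≢e) o V)
    ... | inj₁ V | yes refl with o
    ...   | inj₁ (_ , refl) = inj₂ (inj₂ V)
    ...   | inj₂ (_ , refl) = inj₂ (inj₁ V)

    comp-cover : ∀ {x y v} → Connected G S → Joins e x y → vert S x → vert S v →
                 vert (comp G S e x) v ⊎ vert (comp G S e y) v
    comp-cover conn (inj₁ (refl , refl)) x∈ v∈ with last-crossing (conn _ _ x∈ v∈)
    ... | inj₁ V        = inj₁ V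
    ... | inj₂ (inj₁ V) = inj₁ V
    ... | inj₂ (inj₂ V) = inj₂ V
    comp-cover conn (inj₂ (refl , refl)) x∈ v∈ with last-crossing (conn _ _ x∈ v∈)
    ... | inj₁ V        = inj₁ V
    ... | inj₂ (inj₁ V) = inj₂ V
    ... | inj₂ (inj₂ V) = inj₁ V

    comp-meet : ∀ {x y v} → vert (comp G S e x) v → vert (comp G S e y) v → Walk G S−e x y
    comp-meet P Q = P ++ʷ reverseʷ Q

    comp-edges-disjoint : ∀ {x y f} → ¬ Walk G S−e x y →
                          edge (comp G S e x) f → edge (comp G S e y) f → ⊥
    comp-edges-disjoint no-walk (_ , P , _) (_ , Q , _) = no-walk (comp-meet P Q)

    comp-cong : ∀ {x y} → Walk G S−e x y → SameSub G (comp G S e x) (comp G S e y)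
    comp-cong W = (λ v → mk⇔ (reverseʷ W ++ʷ_) (W ++ʷ_))
                , (λ f → mk⇔ (λ { (p , P , Q) → p , reverseʷ W ++ʷ P , reverseʷ W ++ʷ Q })
                             (λ { (p , P , Q) → p , W ++ʷ P , W ++ʷ Q }))

    comp-whole : ∀ {x} → Connected G S → ¬ edge S e → vert S x → SameSub G S (comp G S e x)
    comp-whole conn e∉S x∈ =
        (λ v → mk⇔ (λ v∈ → avoid (conn _ v x∈ v∈)) comp⊆)
      , (λ f → mk⇔ (λ f∈ → (f∈ , ≢e f∈) , avoid (conn _ _ x∈ (proj₁ (closed S f f∈)))
                                        , avoid (conn _ _ x∈ (proj₂ (closed S f f∈))))
                   (proj₁ ∘ proj₁))
      where
      ≢e : ∀ {f} → edge S f → f ≢ e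
      ≢e f∈ refl = e∉S f∈
      avoid : ∀ {u v} → Walk G S u v → Walk G S−e u v
      avoid = mapʷ (λ _ v∈ → v∈) (λ _ f∈ → f∈ , ≢e f∈)

  -- Tseitin formulas on subgraphs

  same-refl : ∀ {S} → SameSub G S S
  same-refl = (λ _ → ⇔.refl) , (λ _ → ⇔.refl)

  same-sym : ∀ {S T} → SameSub G S T → SameSub G T S
  same-sym (V , E) = (λ v → ⇔.sym (V v)) , (λ f → ⇔.sym (E f))

  agree-back : ∀ {S T c d} → SameSub G S T → AgreeOn G T c d → AgreeOn G S d c
  agree-back (V , _) ag v v∈ = sym (ag v (Equivalence.to (V v) v∈))

  ParityL-edges : ∀ {S T α v es b} → (∀ f → edge S f ⇔ edge T f) →
                  ParityL G S α v es b → ParityL G T α v es b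
  ParityL-edges E nil               = nil
  ParityL-edges E (cnt p q r P)     = cnt (Equivalence.to (E _) p) q r (ParityL-edges E P)
  ParityL-edges E (skip ¬cond P)    =
    skip (λ (p , q , r) → ¬cond (Equivalence.from (E _) p , q , r)) (ParityL-edges E P)

  sat-transport : ∀ {S T c d α} → SameSub G S T → AgreeOn G T c d → Satisfies G S c α → Satisfies G T d α
  sat-transport {T = T} {α = α} (V , E) ag sat v v∈ =
    subst (ParityL G T α v (allFin _)) (ag v v∈) (ParityL-edges E (sat v (Equivalence.from (V v) v∈)))

  sat-cong : ∀ {X c d α} → AgreeOn G X c d → Satisfies G X c α → Satisfies G X d α
  sat-cong {X} = sat-transport (same-refl {X})

  ¬¬sat-transport : ∀ {S T c d α} → SameSub G S T → AgreeOn G T c d →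
                    (¬ ¬ Satisfies G S c α) ⇔ (¬ ¬ Satisfies G T d α)
  ¬¬sat-transport {S} {T} S≈T ag =
    mk⇔ (¬¬-map (sat-transport S≈T ag))
        (¬¬-map (sat-transport (same-sym {S} {T} S≈T) (agree-back {S} {T} S≈T ag)))

  ParityL-assignment : ∀ {S α β v es b} → (∀ f → edge S f → α f ≡ β f) →
                       ParityL G S α v es b → ParityL G S β v es b
  ParityL-assignment agree nil            = nil
  ParityL-assignment agree (cnt p q r P)  = cnt p q (trans (sym (agree _ p)) r) (ParityL-assignment agree P)
  ParityL-assignment agree (skip ¬cond P) =
    skip (λ (p , q , r) → ¬cond (p , q , trans (agree _ p) r)) (ParityL-assignment agree P)

  sat-assignment : ∀ {S c α β} → (∀ f → edge S f → α f ≡ β f) → Satisfies G S c α → Satisfies G S c β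
  sat-assignment agree sat v v∈ = ParityL-assignment agree (sat v v∈)

  unsat-transport : ∀ {S T c d} → SameSub G S T → AgreeOn G T c d → Unsat G S c → Unsat G T d
  unsat-transport {S} {T} S≈T ag unsat (β , sat) =
    unsat (β , sat-transport (same-sym {S} {T} S≈T) (agree-back {S} {T} S≈T ag) sat)

  unsat-cong : ∀ {X c d} → AgreeOn G X c d → Unsat G X c → Unsat G X d
  unsat-cong {X} = unsat-transport (same-refl {X})

  unsat-nonempty : ∀ {X c} → Unsat G X c → ¬ (∀ v → ¬ vert X v)
  unsat-nonempty unsat empty = unsat ((λ _ → false) , λ v v∈ → ⊥-elim (empty v v∈))

  edgesOf : ∀ {S u w} → Walk G S u w → Assignment G
  edgesOf (here _)       = λ _ → false
  edgesOf (step f _ _ W) = 𝟙 f ⊕ edgesOf W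

  module Parity {S : Sub G} (E? : Decidable (edge S)) where

    weight : Assignment G → Fin n → Fin m → Bool
    weight α v f = does (E? f) ∧ (incidence f v ∧ α f)

    parity : Assignment G → Charge G
    parity α v = sum (weight α v)

    weight-true : ∀ α v f → weight α v f ≡ true ⇔ (edge S f × Inc G f v × α f ≡ true)
    weight-true α v f with E? f | incidence f v in inc≡ | α f
    ... | no ¬p | _     | _     = mk⇔ (λ ()) (λ (p , _) → ⊥-elim (¬p p))
    ... | yes p | false | _     =
      mk⇔ (λ ()) (λ (_ , q , _) → ⊥-elim (false≢true (trans (sym inc≡) (Inc⇒incidence q))))
    ... | yes p | true  | false = mk⇔ (λ ()) (λ { (_ , _ , ()) })
    ... | yes p | true  | true  = mk⇔ (λ _ → p , incidence⇒Inc inc≡ , refl) (λ _ → refl)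

    ParityL⇔sum : ∀ α v {k} (g : Fin k → Fin m) b →
                  ParityL G S α v (tabulate g) b ⇔ b ≡ sum (weight α v ∘ g)
    ParityL⇔sum α v {k} g b = mk⇔ (to g) (from g b)
      where
      to : ∀ {k} (g : Fin k → Fin m) {b} → ParityL G S α v (tabulate g) b → b ≡ sum (weight α v ∘ g)
      to {0}     g nil = refl
      to {suc k} g (cnt p q r P)
        rewrite Equivalence.from (weight-true α v (g zero)) (p , q , r) = cong not (to (g ∘ Fin.suc) P)
      to {suc k} g (skip ¬cond P) with weight α v (g zero) in w≡
      ... | false = to (g ∘ Fin.suc) P
      ... | true  = ⊥-elim (¬cond (Equivalence.to (weight-true α v (g zero)) w≡))
      from : ∀ {k} (g : Fin k → Fin m) b → b ≡ sum (weight α v ∘ g) → ParityL G S α v (tabulate g) b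
      from {0}     g b refl = nil
      from {suc k} g b b≡ with weight α v (g zero) in w≡
      ... | true  rewrite b≡ =
        let p , q , r = Equivalence.to (weight-true α v (g zero)) w≡ in cnt p q r (from (g ∘ Fin.suc) _ refl)
      ... | false rewrite b≡ =
        skip (λ cond → false≢true (trans (sym w≡) (Equivalence.from (weight-true α v (g zero)) cond)))
             (from (g ∘ Fin.suc) _ refl)

    sat⇔parity : ∀ {c α} → Satisfies G S c α ⇔ (∀ v → vert S v → parity α v ≡ c v)
    sat⇔parity {c} {α} = mk⇔
      (λ sat v v∈ → sym (Equivalence.to (ParityL⇔sum α v (λ f → f) (c v)) (sat v v∈)))
      (λ eqs v v∈ → Equivalence.from (ParityL⇔sum α v (λ f → f) (c v)) (sym (eqs v v∈)))

    parity-⊕ : ∀ α β → parity (α ⊕ β) ≗ parity α ⊕ parity β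
    parity-⊕ α β v = trans (sum-cong-≗ distrib) (∑-distrib-+ (weight α v) (weight β v))
      where
      distrib : ∀ f → weight (α ⊕ β) v f ≡ weight α v f xor weight β v f
      distrib f = trans (cong (does (E? f) ∧_) (∧-distribˡ-xor (incidence f v) (α f) (β f)))
                        (∧-distribˡ-xor (does (E? f)) _ _)

    parity-𝟙 : ∀ f v → parity (𝟙 f) v ≡ does (E? f) ∧ incidence f v
    parity-𝟙 f v = begin
      sum (weight (𝟙 f) v)                      ≡⟨ sum-single (weight (𝟙 f) v) f off ⟩
      does (E? f) ∧ (incidence f v ∧ 𝟙 f f)     ≡⟨ cong (λ b → does (E? f) ∧ (incidence f v ∧ b)) (𝟙-self f) ⟩
      does (E? f) ∧ (incidence f v ∧ true)      ≡⟨ cong (does (E? f) ∧_) (∧-identityʳ _) ⟩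
      does (E? f) ∧ incidence f v               ∎
      where
      open ≡-Reasoning
      off : ∀ g → g ≢ f → weight (𝟙 f) v g ≡ false
      off g g≢f = trans (cong (λ b → does (E? g) ∧ (incidence g v ∧ b)) (𝟙-other g≢f))
                        (trans (cong (does (E? g) ∧_) (∧-zeroʳ _)) (∧-zeroʳ _))

    parity-zero : parity (λ _ → false) ≗ λ _ → false
    parity-zero v = trans (sum-cong-≗ (λ f → trans (cong (does (E? f) ∧_) (∧-zeroʳ _)) (∧-zeroʳ _)))
                          (sum-replicate-zero m)

    sat-⊕ : ∀ {c d α β} → Satisfies G S c α → Satisfies G S d β → Satisfies G S (c ⊕ d) (α ⊕ β)
    sat-⊕ {α = α} {β} satα satβ = Equivalence.from sat⇔parity λ v v∈ →
      trans (parity-⊕ α β v)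
            (cong₂ _xor_ (Equivalence.to sat⇔parity satα v v∈) (Equivalence.to sat⇔parity satβ v v∈))

    sat-stable : ∀ {c α} → Stable (Satisfies G S c α)
    sat-stable ¬¬sat = Equivalence.from sat⇔parity λ v v∈ →
      decidable-stable (_ Bool.≟ _) (¬¬-map (λ sat → Equivalence.to sat⇔parity sat v v∈) ¬¬sat)

    sat-translate : ∀ {c₁ c₂ β₁ β₂ α} → Satisfies G S c₁ β₁ → Satisfies G S c₂ β₂ →
                    Satisfies G S c₁ α ⇔ Satisfies G S c₂ (α ⊕ (β₁ ⊕ β₂))
    sat-translate {c₁} {c₂} {β₁} {β₂} {α} sat₁ sat₂ = mk⇔
      (λ sat → sat-cong {S} (λ v _ → trans (sym (xor-assoc (c₁ v) (c₁ v) (c₂ v)))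
                                          (cong (_xor c₂ v) (xor-same (c₁ v))))
                            (sat-⊕ sat shift))
      (λ sat → sat-assignment {S} (λ f _ → xor-cancelʳ (α f) ((β₁ ⊕ β₂) f))
                 (sat-cong {S} (λ v _ → trans (cong (c₂ v xor_) (xor-comm (c₁ v) (c₂ v)))
                                              (trans (sym (xor-assoc (c₂ v) (c₂ v) (c₁ v)))
                                                     (cong (_xor c₁ v) (xor-same (c₂ v)))))
                   (sat-⊕ sat shift)))
      where
      shift : Satisfies G S (c₁ ⊕ c₂) (β₁ ⊕ β₂)
      shift = sat-⊕ sat₁ sat₂

    parity-edgesOf : ∀ {u w} (W : Walk G S u w) → parity (edgesOf W) ≗ 𝟙 u ⊕ 𝟙 w
    parity-edgesOf {u} (here _) v = trans (parity-zero v) (sym (xor-same (𝟙 u v)))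
    parity-edgesOf {u} {w} (step f p o W) v = begin
      parity (𝟙 f ⊕ edgesOf W) v                    ≡⟨ parity-⊕ (𝟙 f) (edgesOf W) v ⟩
      parity (𝟙 f) v xor parity (edgesOf W) v       ≡⟨ cong₂ _xor_ (parity-𝟙 f v) (parity-edgesOf W v) ⟩
      (does (E? f) ∧ incidence f v) xor (𝟙 _ v xor 𝟙 w v)
        ≡⟨ cong (λ b → (b ∧ incidence f v) xor (𝟙 _ v xor 𝟙 w v)) (dec-true (E? f) p) ⟩
      incidence f v xor (𝟙 _ v xor 𝟙 w v)          ≡⟨ cong (_xor (𝟙 _ v xor 𝟙 w v)) (incidence-Joins o v) ⟩
      (𝟙 u v xor 𝟙 _ v) xor (𝟙 _ v xor 𝟙 w v)      ≡⟨ xor-telescope (𝟙 u v) _ (𝟙 w v) ⟩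
      𝟙 u v xor 𝟙 w v                               ∎
      where open ≡-Reasoning

    sat-toggle : ∀ {u w d β} (W : Walk G S u w) → Satisfies G S d β →
                 Satisfies G S (d ⊕ (𝟙 u ⊕ 𝟙 w)) (β ⊕ edgesOf W)
    sat-toggle W sat = sat-⊕ sat (Equivalence.from sat⇔parity λ v _ → parity-edgesOf W v)

  -- The parity argument

  module _ {X : Sub G} (V? : Decidable (vert X)) (E? : Decidable (edge X)) (conn : Connected G X) where

    open Parity {X} E?

    flip-toward : ∀ {d β u w} → vert X u → vert X w → Satisfies G X (d ⊕ 𝟙 w) β →
                  Satisfiable G X (d ⊕ 𝟙 u)
    flip-toward {d} {β} {u} {w} u∈ w∈ sat =
      β ⊕ edgesOf W , sat-cong {X} (λ v _ → xor-telescope (d v) (𝟙 w v) (𝟙 u v)) (sat-toggle W sat)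
      where
      W : Walk G X w u
      W = conn w u w∈ u∈

    -- Fix the charge vertex by vertex, starting from the zero assignment: a new defect is either
    -- kept as the only one or cancelled against the previous one by toggling a walk between them.
    sat-up-to-one-vertex : ∀ d → Satisfiable G X d ⊎ ∃ λ w → vert X w × Satisfiable G X (d ⊕ 𝟙 w)
    sat-up-to-one-vertex d = repair (allFin n) d (Equivalence.from sat⇔parity λ v _ → parity-zero v)
                                    (λ v _ v∉ → ⊥-elim (v∉ (∈-allFin v)))
      where
      repair : ∀ (L : List (Fin n)) d {d₀ β} → Satisfies G X d₀ β →
               (∀ v → vert X v → v ∉ L → d₀ v ≡ d v) →
               Satisfiable G X d ⊎ ∃ λ w → vert X w × Satisfiable G X (d ⊕ 𝟙 w)
      repair [] d {β = β} sat agree = inj₁ (β , sat-cong {X} (λ v v∈ → agree v v∈ (λ ())) sat)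
      repair (x ∷ L) d {d₀} sat agree with V? x | d₀ x Bool.≟ d x
      ... | no x∉X | _ = repair L d sat λ v v∈ v∉L → agree v v∈ λ
        { (here refl) → x∉X v∈ ; (there v∈L) → v∉L v∈L }
      ... | yes x∈X | yes same = repair L d sat agree′
        where
        agree′ : ∀ v → vert X v → v ∉ L → d₀ v ≡ d v
        agree′ v v∈ v∉L with v ≟ x
        ... | yes refl = same
        ... | no v≢x  = agree v v∈ λ { (here v≡x) → v≢x v≡x ; (there v∈L) → v∉L v∈L }
      ... | yes x∈X | no differ with repair L (d ⊕ 𝟙 x) sat agree′
        where
        agree′ : ∀ v → vert X v → v ∉ L → d₀ v ≡ (d ⊕ 𝟙 x) v
        agree′ v v∈ v∉L with v ≟ x
        ... | yes refl = trans (¬-not differ) (sym (xor-comm (d v) true))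
        ... | no v≢x  = trans (agree v v∈ λ { (here v≡x) → v≢x v≡x ; (there v∈L) → v∉L v∈L })
                              (sym (xor-identityʳ (d v)))
      ... | inj₁ sat′ = inj₂ (x , x∈X , sat′)
      ... | inj₂ (w , w∈ , β′ , sat′) =
        inj₁ (map₂ (sat-cong {X} λ v _ → xor-cancelʳ (d v) (𝟙 x v)) (flip-toward {d ⊕ 𝟙 x} x∈X w∈ sat′))

    flip-satisfiable : ∀ {d u} → vert X u → Unsat G X d → Satisfiable G X (d ⊕ 𝟙 u)
    flip-satisfiable {d} u∈ unsat with sat-up-to-one-vertex d
    ... | inj₁ sat                = ⊥-elim (unsat sat)
    ... | inj₂ (w , w∈ , _ , sat) = flip-toward {d} u∈ w∈ sat

  unsat-flip : ∀ {X d u} → Connected G X → vert X u → Unsat G X d → ¬ Unsat G X (d ⊕ 𝟙 u)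
  unsat-flip {X} {d} conn u∈ unsat unsat′ =
    ¬¬-decidable (vert X) λ V? → ¬¬-decidable (edge X) λ E? →
    unsat′ (flip-satisfiable {X} V? E? conn u∈ unsat)

  unsat-toggle : ∀ {X d u w} → Walk G X u w → Unsat G X d → Unsat G X (d ⊕ (𝟙 u ⊕ 𝟙 w))
  unsat-toggle {X} {d} {u} {w} W unsat (β , sat) = ¬¬-decidable (edge X) λ E? →
    unsat (β ⊕ edgesOf W , sat-cong {X} (λ v _ → xor-cancelʳ (d v) (𝟙 u v xor 𝟙 w v))
                                      (Parity.sat-toggle E? W sat))

  -- Splitting a formula at an edge

  gamma-incidence : ∀ d e ℓ v → gamma G d e ℓ v ≡ d v xor (incidence e v ∧ ℓ)
  gamma-incidence d e false v = sym (trans (cong (d v xor_) (∧-zeroʳ _)) (xor-identityʳ (d v)))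
  gamma-incidence d e true  v = trans (xor-assoc (d v) _ _) (cong (d v xor_) (sym (∧-identityʳ _)))

  gamma-⊕ : ∀ d h e ℓ → gamma G (d ⊕ h) e ℓ ≗ gamma G d e ℓ ⊕ h
  gamma-⊕ d h e ℓ v = begin
    gamma G (d ⊕ h) e ℓ v                     ≡⟨ gamma-incidence (d ⊕ h) e ℓ v ⟩
    (d v xor h v) xor (incidence e v ∧ ℓ)     ≡⟨ xor-swapʳ (d v) (h v) _ ⟩
    (d v xor (incidence e v ∧ ℓ)) xor h v     ≡⟨ cong (_xor h v) (gamma-incidence d e ℓ v) ⟨
    gamma G d e ℓ v xor h v                   ∎
    where open ≡-Reasoning

  module _ {S : Sub G} {e : Fin m} (S? : Decidable (edge S)) (e∈S : edge S e) where

    parity-comp : ∀ {x} (C? : Decidable (edge (comp G S e x))) α {v} → vert (comp G S e x) v →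
                  Parity.parity {S} S? α v ≡ Parity.parity {comp G S e x} C? α v xor (incidence e v ∧ α e)
    parity-comp {x} C? α {v} v∈C = begin
      sum wS                                        ≡⟨ sum-cong-≗ pointwise ⟩
      sum (wC ⊕ through-e)                          ≡⟨ ∑-distrib-+ wC through-e ⟩
      sum wC xor sum through-e                      ≡⟨ cong (sum wC xor_) (sum-single through-e e off-e) ⟩
      sum wC xor (𝟙 e e ∧ (incidence e v ∧ α e))
        ≡⟨ cong (λ b → sum wC xor (b ∧ (incidence e v ∧ α e))) (𝟙-self e) ⟩
      sum wC xor (incidence e v ∧ α e)              ∎
      where
      open ≡-Reasoning
      wS wC through-e : Fin m → Bool
      wS = Parity.weight {S} S? α v
      wC = Parity.weight {comp G S e x} C? α v
      through-e f = 𝟙 e f ∧ (incidence f v ∧ α f)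
      off-e : ∀ f → f ≢ e → through-e f ≡ false
      off-e f f≢e = cong (_∧ _) (𝟙-other f≢e)
      pointwise : ∀ f → wS f ≡ (wC ⊕ through-e) f
      pointwise f with f ≟ e
      ... | yes refl rewrite dec-true (S? e) e∈S | dec-false (C? e) (λ e∈C → proj₂ (proj₁ e∈C) refl) = refl
      ... | no f≢e = trans (∧-cong-if (incidence f v ∧ α f) same-edge) (sym (xor-identityʳ _))
        where
        same-edge : incidence f v ∧ α f ≡ true → does (S? f) ≡ does (C? f)
        same-edge f~v = does-⇔
          (mk⇔ (λ f∈S → comp-incident S e v∈C f∈S f≢e (incidence⇒Inc (∧-conicalˡ _ _ f~v)))
               (proj₁ ∘ proj₁))
          (S? f) (C? f)

    private
      module PS = Parity {S} S?

    sat→sat-comp : ∀ {x d α} (C? : Decidable (edge (comp G S e x))) →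
                   Satisfies G S d α → Satisfies G (comp G S e x) (gamma G d e (α e)) α
    sat→sat-comp {x} {d} {α} C? sat = Equivalence.from PC.sat⇔parity λ v v∈C → begin
      PC.parity α v                                                 ≡⟨ xor-cancelʳ _ _ ⟨
      (PC.parity α v xor (incidence e v ∧ α e)) xor (incidence e v ∧ α e)
                                                                    ≡⟨ cong (_xor _) (parity-comp C? α v∈C) ⟨
      PS.parity α v xor (incidence e v ∧ α e)
        ≡⟨ cong (_xor _) (Equivalence.to PS.sat⇔parity sat v (comp⊆ S e v∈C)) ⟩
      d v xor (incidence e v ∧ α e)                 ≡⟨ gamma-incidence d e (α e) v ⟨
      gamma G d e (α e) v                           ∎
      where
      open ≡-Reasoning
      module PC = Parity {comp G S e x} C?

    sat-comps→sat : ∀ {x y d α} (X? : Decidable (edge (comp G S e x))) (Y? : Decidable (edge (comp G S e y))) →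
                    Connected G S → Joins e x y → vert S x →
                    Satisfies G (comp G S e x) (gamma G d e (α e)) α →
                    Satisfies G (comp G S e y) (gamma G d e (α e)) α → Satisfies G S d α
    sat-comps→sat {x} {y} {d} {α} X? Y? conn x~y x∈S satX satY = Equivalence.from PS.sat⇔parity λ v v∈S →
      [ via X? satX , via Y? satY ]′ (comp-cover S e conn x~y x∈S v∈S)
      where
      via : ∀ {z} (Z? : Decidable (edge (comp G S e z))) → Satisfies G (comp G S e z) (gamma G d e (α e)) α →
            ∀ {v} → vert (comp G S e z) v → PS.parity α v ≡ d v
      via {z} Z? satZ {v} v∈Z = begin
        PS.parity α v                                     ≡⟨ parity-comp Z? α v∈Z ⟩
        PZ.parity α v xor (incidence e v ∧ α e)
          ≡⟨ cong (_xor _) (Equivalence.to PZ.sat⇔parity satZ v v∈Z) ⟩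
        gamma G d e (α e) v xor (incidence e v ∧ α e)     ≡⟨ cong (_xor _) (gamma-incidence d e (α e) v) ⟩
        (d v xor (incidence e v ∧ α e)) xor (incidence e v ∧ α e) ≡⟨ xor-cancelʳ _ _ ⟩
        d v                                               ∎
        where
        open ≡-Reasoning
        module PZ = Parity {comp G S e z} Z?

  ¬¬sat⇔comps : ∀ {S e x y d α} → Connected G S → edge S e → Joins e x y → vert S x →
                (¬ ¬ Satisfies G S d α) ⇔
                (¬ ¬ Satisfies G (comp G S e x) (gamma G d e (α e)) α ×
                 ¬ ¬ Satisfies G (comp G S e y) (gamma G d e (α e)) α)
  ¬¬sat⇔comps {S} {e} {x} {y} conn e∈S x~y x∈S = mk⇔
    (λ ¬¬sat → to ¬¬sat , to ¬¬sat)
    (λ (¬¬satX , ¬¬satY) → do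
      satX ← ¬¬satX
      satY ← ¬¬satY
      S? ← ¬¬-decidable (edge S)
      X? ← ¬¬-decidable (edge (comp G S e x))
      Y? ← ¬¬-decidable (edge (comp G S e y))
      pure (sat-comps→sat S? e∈S X? Y? conn x~y x∈S satX satY))
    where
    to : ∀ {z d α} → ¬ ¬ Satisfies G S d α → ¬ ¬ Satisfies G (comp G S e z) (gamma G d e (α e)) α
    to {z} ¬¬sat = do
      sat ← ¬¬sat
      S? ← ¬¬-decidable (edge S)
      Z? ← ¬¬-decidable (edge (comp G S e z))
      pure (sat→sat-comp S? e∈S Z? sat)

  𝟙-outside : ∀ {X d w} → ¬ vert X w → AgreeOn G X (d ⊕ 𝟙 w) d
  𝟙-outside {d = d} w∉X v v∈X = trans (cong (d v xor_) (𝟙-other λ { refl → w∉X v∈X })) (xor-identityʳ (d v))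

  sat-flip→mem : ∀ {Y d w α} → Unsat G Y d → Satisfies G Y (d ⊕ 𝟙 w) α → ¬ ¬ vert Y w
  sat-flip→mem {Y} unsat sat w∉Y = unsat (_ , sat-cong {Y} (𝟙-outside {Y} w∉Y) sat)

  -- If Y is unsatisfiable with dY, satisfying it with dY ⊕ 𝟙 w puts w in Y, hence outside X.
  ¬¬sat-drop-flip : ∀ {X Y dX dY w α} → (∀ v → vert X v → vert Y v → ⊥) → Unsat G Y dY →
                    ¬ ¬ Satisfies G Y (dY ⊕ 𝟙 w) α →
                    (¬ ¬ Satisfies G X (dX ⊕ 𝟙 w) α) ⇔ (¬ ¬ Satisfies G X dX α)
  ¬¬sat-drop-flip {X} {Y} {dX} {w = w} disjoint unsat ¬¬satY =
    mk⇔ (¬¬-map (sat-cong {X} away)) (¬¬-map (sat-cong {X} (agree-back {X} {X} (same-refl {X}) away)))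
    where
    w∉X : ¬ vert X w
    w∉X w∈X = ¬¬satY λ satY → sat-flip→mem {Y} unsat satY (disjoint w w∈X)
    away : AgreeOn G X (dX ⊕ 𝟙 w) dX
    away = 𝟙-outside {X} w∉X

-- Circuits

module _ {m : ℕ} where

  wk : ∀ {g} → Wire m g → Wire m (suc g)
  wk (lit x ℓ) = lit x ℓ
  wk (const ℓ) = const ℓ
  wk (gate i)  = gate (Fin.suc i)

  eval-wk : ∀ {g} (C : Circuit m g) gt α x → evalW (C ▷ gt) α (wk x) ≡ evalW C α x
  eval-wk C gt α (lit x true)  = refl
  eval-wk C gt α (lit x false) = refl
  eval-wk C gt α (const ℓ)     = refl
  eval-wk C (and _ _) α (gate i) = refl
  eval-wk C (or _ _)  α (gate i) = refl

  vars-wk : ∀ {g} (C : Circuit m g) gt x {y} → VarsW (C ▷ gt) (wk x) y → VarsW C x y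
  vars-wk C gt (lit x ℓ) p = p
  vars-wk C (and _ _) (gate i) p = p
  vars-wk C (or _ _)  (gate i) p = p

  infix 4 _≼_

  data _≼_ : ∀ {g g′} → Circuit m g → Circuit m g′ → Set where
    ≼-refl : ∀ {g} {C : Circuit m g} → C ≼ C
    ≼-step : ∀ {g g′} {C : Circuit m g} {C′ : Circuit m g′} → C ≼ C′ → (gt : Gate m g′) → C ≼ C′ ▷ gt

  ≼-trans : ∀ {g g′ g″} {C : Circuit m g} {C′ : Circuit m g′} {C″ : Circuit m g″} →
            C ≼ C′ → C′ ≼ C″ → C ≼ C″
  ≼-trans E ≼-refl        = E
  ≼-trans E (≼-step F gt) = ≼-step (≼-trans E F) gt

  weaken : ∀ {g g′} {C : Circuit m g} {C′ : Circuit m g′} → C ≼ C′ → Wire m g → Wire m g′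
  weaken ≼-refl       x = x
  weaken (≼-step E _) x = wk (weaken E x)

  eval-weaken : ∀ {g g′} {C : Circuit m g} {C′ : Circuit m g′} (E : C ≼ C′) α x →
                evalW C′ α (weaken E x) ≡ evalW C α x
  eval-weaken ≼-refl α x = refl
  eval-weaken {C′ = C′ ▷ gt} (≼-step E gt) α x = trans (eval-wk C′ gt α (weaken E x)) (eval-weaken E α x)

  vars-weaken : ∀ {g g′} {C : Circuit m g} {C′ : Circuit m g′} (E : C ≼ C′) x {y} →
                VarsW C′ (weaken E x) y → VarsW C x y
  vars-weaken ≼-refl x p = p
  vars-weaken {C′ = C′ ▷ gt} (≼-step E gt) x p = vars-weaken E x (vars-wk C′ gt (weaken E x) p)

  Disjoint : ∀ {g} → Circuit m g → Wire m g → Wire m g → Set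
  Disjoint C x z = ∀ y → VarsW C x y → VarsW C z y → ⊥

  -- (¬x_e ∧ (p₀ ∧ q₀)) ∨ (x_e ∧ (p₁ ∧ q₁))
  module Gadget {g} (C : Circuit m g) (e : Fin m) (p q : Bool → Wire m g) where

    private
      C₂ : Circuit m (2 + g)
      C₂ = (C ▷ and (p false) (q false)) ▷ and (lit e false) (gate zero)

      C₂-extends : C ≼ C₂
      C₂-extends = ≼-step (≼-step ≼-refl _) _

    combined : Circuit m (5 + g)
    combined = ((C₂ ▷ and (weaken C₂-extends (p true)) (weaken C₂-extends (q true)))
                  ▷ and (lit e true) (gate zero))
                  ▷ or (gate (Fin.suc (Fin.suc zero))) (gate zero)

    out : Wire m (5 + g)
    out = gate zero

    extends : C ≼ combined
    extends = ≼-trans C₂-extends (≼-step (≼-step (≼-step ≼-refl _) _) _)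

    eval-out : ∀ α → evalW combined α out ≡ evalW C α (p (α e)) ∧ evalW C α (q (α e))
    eval-out α with α e
    ... | false = ∨-identityʳ _
    ... | true  = cong₂ _∧_ (eval-weaken C₂-extends α (p true)) (eval-weaken C₂-extends α (q true))

    vars-out : ∀ {y} → VarsW combined out y → e ≡ y ⊎ ∃ λ ℓ → VarsW C (p ℓ) y ⊎ VarsW C (q ℓ) y
    vars-out (inj₁ (inj₁ e≡y))        = inj₁ e≡y
    vars-out (inj₁ (inj₂ (inj₁ P)))   = inj₂ (false , inj₁ P)
    vars-out (inj₁ (inj₂ (inj₂ Q)))   = inj₂ (false , inj₂ Q)
    vars-out (inj₂ (inj₁ e≡y))        = inj₁ e≡y
    vars-out (inj₂ (inj₂ (inj₁ P)))   = inj₂ (true , inj₁ (vars-weaken C₂-extends (p true) P))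
    vars-out (inj₂ (inj₂ (inj₂ Q)))   = inj₂ (true , inj₂ (vars-weaken C₂-extends (q true) Q))

    decomposable : Decomposable C → (∀ ℓ → Disjoint C (p ℓ) (q ℓ)) →
                   (∀ ℓ → ¬ VarsW C (p ℓ) e) → (∀ ℓ → ¬ VarsW C (q ℓ) e) → Decomposable combined
    decomposable dC pq-apart e∉p e∉q =
      ((((dC , pq-apart false) , λ { y refl (inj₁ P) → e∉p false P ; y refl (inj₂ Q) → e∉q false Q })
       , λ y P Q → pq-apart true y (vars-weaken C₂-extends (p true) P) (vars-weaken C₂-extends (q true) Q))
       , λ { y refl (inj₁ P) → e∉p true (vars-weaken C₂-extends (p true) P)
           ; y refl (inj₂ Q) → e∉q true (vars-weaken C₂-extends (q true) Q) })

  module _ (t : Fin m → Bool) where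

    shiftʷ : ∀ {g} → Wire m g → Wire m g
    shiftʷ (lit x ℓ) = lit x (ℓ xor t x)
    shiftʷ (const ℓ) = const ℓ
    shiftʷ (gate i)  = gate i

    shiftᶜ : ∀ {g} → Circuit m g → Circuit m g
    shiftᶜ []             = []
    shiftᶜ (C ▷ and x z)  = shiftᶜ C ▷ and (shiftʷ x) (shiftʷ z)
    shiftᶜ (C ▷ or x z)   = shiftᶜ C ▷ or (shiftʷ x) (shiftʷ z)

    eval-shift-lit : ∀ {g g′} (C : Circuit m g) (C′ : Circuit m g′) α x ℓ →
                     evalW C α (lit x (ℓ xor t x)) ≡ evalW C′ (α ⊕ t) (lit x ℓ)
    eval-shift-lit C C′ α x true  = literal (t x)
      where
      literal : ∀ u → evalW C α (lit x (true xor u)) ≡ α x xor u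
      literal false = sym (xor-identityʳ (α x))
      literal true  = sym (xor-comm (α x) true)
    eval-shift-lit C C′ α x false = literal (t x)
      where
      literal : ∀ u → evalW C α (lit x (false xor u)) ≡ not (α x xor u)
      literal false = cong not (sym (xor-identityʳ (α x)))
      literal true  = trans (sym (not-involutive (α x))) (cong not (sym (xor-comm (α x) true)))

    mutual
      eval-shift : ∀ {g} (C : Circuit m g) α x → evalW (shiftᶜ C) α (shiftʷ x) ≡ evalW C (α ⊕ t) x
      eval-shift C α (lit x ℓ) = eval-shift-lit (shiftᶜ C) C α x ℓ
      eval-shift C α (const ℓ) = refl
      eval-shift C α (gate i)  = eval-shiftᵍ C α i

      eval-shiftᵍ : ∀ {g} (C : Circuit m g) α i → evalG (shiftᶜ C) α i ≡ evalG C (α ⊕ t) i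
      eval-shiftᵍ (C ▷ and x z) α zero       = cong₂ _∧_ (eval-shift C α x) (eval-shift C α z)
      eval-shiftᵍ (C ▷ or x z)  α zero       = cong₂ _∨_ (eval-shift C α x) (eval-shift C α z)
      eval-shiftᵍ (C ▷ and _ _) α (Fin.suc i) = eval-shiftᵍ C α i
      eval-shiftᵍ (C ▷ or _ _)  α (Fin.suc i) = eval-shiftᵍ C α i

    mutual
      vars-shift : ∀ {g} (C : Circuit m g) x {y} → VarsW (shiftᶜ C) (shiftʷ x) y → VarsW C x y
      vars-shift C (lit x ℓ) p = p
      vars-shift C (gate i)  p = vars-shiftᵍ C i p

      vars-shiftᵍ : ∀ {g} (C : Circuit m g) i {y} → VarsG (shiftᶜ C) i y → VarsG C i y
      vars-shiftᵍ (C ▷ and x z) zero (inj₁ p) = inj₁ (vars-shift C x p)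
      vars-shiftᵍ (C ▷ and x z) zero (inj₂ p) = inj₂ (vars-shift C z p)
      vars-shiftᵍ (C ▷ or x z)  zero (inj₁ p) = inj₁ (vars-shift C x p)
      vars-shiftᵍ (C ▷ or x z)  zero (inj₂ p) = inj₂ (vars-shift C z p)
      vars-shiftᵍ (C ▷ and _ _) (Fin.suc i) p = vars-shiftᵍ C i p
      vars-shiftᵍ (C ▷ or _ _)  (Fin.suc i) p = vars-shiftᵍ C i p

    decomposable-shift : ∀ {g} (C : Circuit m g) → Decomposable C → Decomposable (shiftᶜ C)
    decomposable-shift []            _         = _
    decomposable-shift (C ▷ and x z) (dC , dj) =
      decomposable-shift C dC , λ y p q → dj y (vars-shift C x p) (vars-shift C z q)
    decomposable-shift (C ▷ or x z)  dC        = decomposable-shift C dC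

  record Extension {g} (C : Circuit m g) (extra : ℕ) (P : ∀ {g′} → Circuit m g′ → Wire m g′ → Set) : Set where
    field
      {gates}      : ℕ
      extended     : Circuit m gates
      extends      : C ≼ extended
      decomposable : Decomposable extended
      bounded      : gates ≤ extra + g
      wire         : Wire m gates
      realises     : P extended wire

  module Build {N n : ℕ} (Spec : Fin N → Fin n → ∀ {g} → Circuit m g → Wire m g → Set)
               (spec-weaken : ∀ {i w g g′} {C : Circuit m g} {C′ : Circuit m g′} (E : C ≼ C′) {x} →
                              Spec i w C x → Spec i w C′ (weaken E x))
               (extra : ℕ)
               (step : ∀ i w {g} (C : Circuit m g) → Decomposable C → (env : Fin N → Fin n → Wire m g) →
                       (∀ j → i < j → ∀ w′ → Spec j w′ C (env j w′)) → Extension C extra (Spec i w)) where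

    record Built (R : Fin N → Fin n → Set) (bound : ℕ) : Set where
      field
        {gates}      : ℕ
        built        : Circuit m gates
        decomposable : Decomposable built
        bounded      : gates ≤ bound
        wires        : Fin N → Fin n → Wire m gates
        realised     : ∀ j w → R j w → Spec j w built (wires j w)

    weaken-built : ∀ {R R′ t t′} → (∀ j w → R′ j w → R j w) → t ≤ t′ → Built R t → Built R′ t′
    weaken-built R′⇒R t≤t′ b = record
      { built = built ; decomposable = decomposable ; bounded = ≤-trans bounded t≤t′
      ; wires = wires ; realised = λ j w r → realised j w (R′⇒R j w r) }
      where open Built b

    empty : Built (λ _ _ → ⊥) 0
    empty = record { built = [] ; decomposable = _ ; bounded = ≤-refl ; wires = λ _ _ → const false
                   ; realised = λ _ _ () }

    add : ∀ {R t} i w → Built R t → (∀ j w′ → i < j → R j w′) →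
          Built (λ j w′ → R j w′ ⊎ (j ≡ i × w′ ≡ w)) (extra + t)
    add {R} i w b req = record
      { built = X.extended ; decomposable = X.decomposable
      ; bounded = ≤-trans X.bounded (+-monoʳ-≤ extra B.bounded)
      ; wires = wires′ ; realised = realised′ }
      where
      module B = Built b
      module X = Extension (step i w B.built B.decomposable B.wires λ j i<j w′ → B.realised j w′ (req j w′ i<j))
      wires′ : Fin N → Fin n → Wire m X.gates
      wires′ j w′ with j ≟ i | w′ ≟ w
      ... | yes _ | yes _ = X.wire
      ... | yes _ | no _  = weaken X.extends (B.wires j w′)
      ... | no _  | _     = weaken X.extends (B.wires j w′)
      realised′ : ∀ j w′ → R j w′ ⊎ (j ≡ i × w′ ≡ w) → Spec j w′ X.extended (wires′ j w′)
      realised′ j w′ r with j ≟ i | w′ ≟ w | r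
      ... | yes refl | yes refl | _                  = X.realises
      ... | yes _    | no _     | inj₁ r′            = spec-weaken X.extends (B.realised j w′ r′)
      ... | yes _    | no w′≢w  | inj₂ (_ , w′≡w)    = ⊥-elim (w′≢w w′≡w)
      ... | no _     | _        | inj₁ r′            = spec-weaken X.extends (B.realised j w′ r′)
      ... | no j≢i   | _        | inj₂ (j≡i , _)     = ⊥-elim (j≢i j≡i)

    layer : ∀ {R t} i (ws : List (Fin n)) → Built R t → (∀ j w → i < j → R j w) →
            Built (λ j w → R j w ⊎ (j ≡ i × w ∈ ws)) (length ws * extra + t)
    layer i []       b req = weaken-built (λ { _ _ (inj₁ r) → r ; _ _ (inj₂ (_ , ())) }) ≤-refl b
    layer {R} {t} i (w ∷ ws) b req =
      weaken-built regroup (≤-reflexive (sym (+-assoc extra (length ws * extra) t)))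
                   (add i w (layer i ws b req) λ j w′ i<j → inj₁ (req j w′ i<j))
      where
      regroup : ∀ j w′ → R j w′ ⊎ (j ≡ i × w′ ∈ w ∷ ws) → (R j w′ ⊎ (j ≡ i × w′ ∈ ws)) ⊎ (j ≡ i × w′ ≡ w)
      regroup j w′ (inj₁ r)                   = inj₁ (inj₁ r)
      regroup j w′ (inj₂ (j≡i , here w′≡w))   = inj₂ (j≡i , w′≡w)
      regroup j w′ (inj₂ (j≡i , there w′∈ws)) = inj₁ (inj₂ (j≡i , w′∈ws))

    from : ∀ d L → L + d ≡ N → Built (λ j _ → L ≤ toℕ j) (d * (n * extra))
    from 0       L L+0≡N = weaken-built none z≤n empty
      where
      none : ∀ j w → L ≤ toℕ j → ⊥
      none j _ L≤j = <⇒≱ (toℕ<n j) (subst (_≤ toℕ j) (trans (sym (+-identityʳ L)) L+0≡N) L≤j)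
    from (suc d) L L+d≡N =
      weaken-built covered
        (≤-reflexive (cong (λ k → k * extra + d * (n * extra)) (length-tabulate {n = n} (λ (j : Fin n) → j))))
                   (layer i (allFin n) (from d (suc L) (trans (sym (+-suc L d)) L+d≡N)) later)
      where
      L<N : L ℕ.< N
      L<N = subst (L ℕ.<_) L+d≡N (m<m+n L (s≤s z≤n))
      i : Fin N
      i = fromℕ< L<N
      later : ∀ j w → i < j → suc L ≤ toℕ j
      later j w i<j = subst (λ k → suc k ≤ toℕ j) (toℕ-fromℕ< L<N) i<j
      covered : ∀ j w → L ≤ toℕ j → suc L ≤ toℕ j ⊎ (j ≡ i × w ∈ allFin n)
      covered j w L≤j with m≤n⇒m<n∨m≡n L≤j
      ... | inj₁ L<j = inj₁ L<j
      ... | inj₂ L≡j = inj₂ (toℕ-injective (trans (sym L≡j) (sym (toℕ-fromℕ< L<N))) , ∈-allFin w)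

    build : Built (λ _ _ → ⊤) (N * (n * extra))
    build = weaken-built (λ _ _ _ → z≤n) ≤-refl (from N 0 refl)

-- Well-structured branching programs

module _ {n m s : ℕ} (B : BP n m s) where

  run : ∀ α k → ∃ λ v → Run B α k v
  run α k = go k (>-wellFounded k)
    where
    go : ∀ k → Acc _>_ k → ∃ λ v → Run B α k v
    go k (acc rs) with node B k in node≡
    ... | sink v       = v , atSink node≡
    ... | dec e k₀ k₁  = map₂ (atDec node≡) (go _ (rs (ordered-next (α e))))
      where
      ordered-next : ∀ ℓ → (if ℓ then k₁ else k₀) > k
      ordered-next false = proj₁ (ordered B k e k₀ k₁ node≡)
      ordered-next true  = proj₂ (ordered B k e k₀ k₁ node≡)

module WellStructuredBP {n m s : ℕ} (G : Graph n m) (B : BP n m (suc s)) {c : Charge G}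
                        (ws : WellStructured G B c zero) where

  open WellStructured ws

  -- Membership in a subgraph is not decidable, so facts about it are only available under ¬¬;
  -- SatAt is ¬¬-stable, which is all the construction needs.
  SatAt : Fin (suc s) → Fin n → Assignment G → Set
  SatAt k w α = ¬ ¬ Satisfies G (sub k) (chg k ⊕ 𝟙 w) α

  source-sat⇔ : ∀ w α → SatAt zero w α ⇔ Satisfies G (fullSub G) (c ⊕ 𝟙 w) α
  source-sat⇔ w α = mk⇔ (Parity.sat-stable G {fullSub G} (λ _ → yes _) ∘ Equivalence.to transport)
                        (Equivalence.from transport ∘ λ sat ¬sat → ¬sat sat)
    where
    transport = ¬¬sat-transport G {sub zero} {fullSub G} (proj₁ source)
                  λ v _ → cong (_xor 𝟙 w v) (proj₂ source v _)

  Spec : Fin (suc s) → Fin n → ∀ {g} → Circuit m g → Wire m g → Set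
  Spec k w C x = (∀ α → (evalW C α x ≡ true) ⇔ SatAt k w α) × (∀ y → VarsW C x y → ¬ ¬ edge (sub k) y)

  spec-weaken : ∀ {k w g g′} {C : Circuit m g} {C′ : Circuit m g′} (E : C ≼ C′) {x} →
                Spec k w C x → Spec k w C′ (weaken E x)
  spec-weaken E {x} (sem , vars) = (λ α → ⇔.trans (≡-true⇔ (eval-weaken E α x)) (sem α))
                                 , λ y v → vars y (vars-weaken E x v)

  sink-sat⇔ : ∀ {k v} → node B k ≡ sink v → ∀ w α → SatAt k w α ⇔ (𝟙 w v ≡ true)
  sink-sat⇔ {k} {v} node≡ w α =
    mk⇔ (λ ¬¬sat → decidable-stable (𝟙 w v Bool.≟ true) (¬¬-map from-sat ¬¬sat))
        (λ w≡v → λ ¬sat → ¬sat (Equivalence.from P.sat⇔parity λ u u≡v → parity-at u u≡v w≡v))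
    where
    single = proj₁ (sinks k v node≡)
    no-edges : Decidable (edge (sub k))
    no-edges f = no (Equivalence.to (proj₂ single f))
    module P = Parity G {sub k} no-edges
    parity-false : ∀ u → P.parity α u ≡ false
    parity-false u = sum-replicate-zero m
    at-v : ∀ u → vert (sub k) u → u ≡ v
    at-v u = Equivalence.to (proj₁ single u)
    charge-at-v : (chg k ⊕ 𝟙 w) v ≡ not (𝟙 w v)
    charge-at-v = cong (_xor 𝟙 w v) (proj₂ (sinks k v node≡))
    from-sat : Satisfies G (sub k) (chg k ⊕ 𝟙 w) α → 𝟙 w v ≡ true
    from-sat sat = begin
      𝟙 w v              ≡⟨ not-involutive (𝟙 w v) ⟨
      not (not (𝟙 w v))  ≡⟨ cong not charge-at-v ⟨
      not ((chg k ⊕ 𝟙 w) v)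
        ≡⟨ cong not (Equivalence.to P.sat⇔parity sat v (Equivalence.from (proj₁ single v) refl)) ⟨
      not (P.parity α v) ≡⟨ cong not (parity-false v) ⟩
      true               ∎
      where open ≡-Reasoning
    parity-at : ∀ u → vert (sub k) u → 𝟙 w v ≡ true → P.parity α u ≡ (chg k ⊕ 𝟙 w) u
    parity-at u u∈ w≡v with at-v u u∈
    ... | refl = trans (parity-false v) (sym (trans charge-at-v (cong not w≡v)))

  run-ends-at-defect : ∀ {k x v α} → Satisfies G (sub k) (chg k ⊕ 𝟙 x) α → Run B α k v → v ≡ x
  run-ends-at-defect {k} {x} {v} {α} sat R with v ≟ x
  ... | yes v≡x = v≡x
  ... | no v≢x  = ⊥-elim (proj₂ found (subst (ParityL G (sub k) α v (allFin m))
                                              (trans (cong (chg k v xor_) (𝟙-other v≢x)) (xor-identityʳ (chg k v)))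
                                              (sat v (proj₁ found))))
    where found = comput k α v R

  module DecisionNode {k e k₀ k₁} (node≡ : node B k ≡ dec e k₀ k₁) where

    S : Sub G
    S = sub k

    a b : Fin n
    a = end₁ G e
    b = end₂ G e

    Comp : Fin n → Sub G
    Comp = comp G S e

    next : Bool → Fin (suc s)
    next ℓ = if ℓ then k₁ else k₀

    γ : Bool → Charge G
    γ = gamma G (chg k) e

    LandsIn : Bool → Fin n → Set
    LandsIn ℓ x = SameSub G (sub (next ℓ)) (Comp x) × AgreeOn G (Comp x) (chg (next ℓ)) (γ ℓ)

    tag : ∀ ℓ → SuccOK G B S (chg k) e ℓ (sub (next ℓ)) (chg (next ℓ))
    tag false = proj₁ (decs k e k₀ k₁ node≡)
    tag true  = proj₂ (decs k e k₀ k₁ node≡)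

    landing : ∀ ℓ → ∃ λ x → Inc G e x × LandsIn ℓ x
    landing ℓ with tag ℓ
    ... | inj₁ (_ , L) = a , inj₁ refl , L
    ... | inj₂ (_ , L) = b , inj₂ refl , L

    unsat-landing : ∀ {ℓ x} → LandsIn ℓ x → Unsat G (Comp x) (γ ℓ)
    unsat-landing {ℓ} {x} (S≈ , ag) = unsat-transport G {sub (next ℓ)} {Comp x} S≈ ag (unsat (next ℓ))

    next-edge⊆ : ∀ ℓ {f} → edge (sub (next ℓ)) f → edge S f × f ≢ e
    next-edge⊆ ℓ {f} f∈ = proj₁ (Equivalence.to (proj₂ (proj₁ (proj₂ (proj₂ (landing ℓ)))) f) f∈)

    γ-flip : ∀ ℓ v → γ (not ℓ) v ≡ γ ℓ v xor incidence G e v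
    γ-flip false v = xor-assoc (chg k v) _ _
    γ-flip true  v = trans (sym (xor-cancelʳ (chg k v) (incidence G e v)))
                           (cong (_xor incidence G e v) (sym (xor-assoc (chg k v) _ _)))

    γ-away : ∀ ℓ {x y} → Joins G e x y → ¬ vert (Comp y) x → AgreeOn G (Comp y) (γ (not ℓ)) (γ ℓ ⊕ 𝟙 y)
    γ-away ℓ {x} {y} x~y x∉ v v∈ = begin
      γ (not ℓ) v                   ≡⟨ γ-flip ℓ v ⟩
      γ ℓ v xor incidence G e v     ≡⟨ cong (γ ℓ v xor_) (incidence-Joins G x~y v) ⟩
      γ ℓ v xor (𝟙 x v xor 𝟙 y v)
        ≡⟨ cong (λ z → γ ℓ v xor (z xor 𝟙 y v)) (𝟙-other {u = x} {v} λ { refl → x∉ v∈ }) ⟩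
      γ ℓ v xor 𝟙 y v               ∎
      where open ≡-Reasoning

    -- If e ∉ G_k, the x_e-successor is all of G_k, charged with c_k + 1_a + 1_b. An assignment that
    -- violates only χ_x at node k and sets x_e then reaches a sink that node k forces to be x and
    -- that the successor forbids to be x.
    ¬¬e∈S : ¬ ¬ edge S e
    ¬¬e∈S e∉S = unsat-nonempty G {Comp x} (unsat-landing L) λ v v∈Cx →
      ¬¬-decidable (vert S) λ V? → ¬¬-decidable (edge S) λ E? → contradiction V? E? (walk-head∈ G v∈Cx)
      where
      x = proj₁ (landing true)
      x~e = proj₁ (proj₂ (landing true))
      L = proj₂ (proj₂ (landing true))
      contradiction : Decidable (vert S) → Decidable (edge S) → vert S x → ⊥
      contradiction V? E? x∈S with flip-satisfiable G V? E? (conn k) x∈S (unsat k)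
      ... | β , satβ = violated₁ (subst (λ u → Chi G (sub k₁) (chg k₁) α′ u) (sym v≡x) chi-x)
        where
        S≈Cx : SameSub G S (Comp x)
        S≈Cx = comp-whole G S e (conn k) e∉S x∈S
        α′ : Assignment G
        α′ f = β f ∨ 𝟙 e f
        α′e : α′ e ≡ true
        α′e = trans (cong (β e ∨_) (𝟙-self e)) (∨-zeroʳ (β e))
        sat′ : Satisfies G S (chg k ⊕ 𝟙 x) α′
        sat′ = sat-assignment G {S} (λ f f∈ → sym (trans (cong (β f ∨_) (𝟙-other λ { refl → e∉S f∈ }))
                                                          (∨-identityʳ (β f)))) satβ
        reached = run B α′ (next (α′ e))
        v = proj₁ reached
        v≡x : v ≡ x
        v≡x = run-ends-at-defect sat′ (atDec node≡ (proj₂ reached))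
        violated₁ = proj₂ (comput k₁ α′ v (subst (λ ℓ → Run B α′ (next ℓ) v) α′e (proj₂ reached)))
        charge-x : (chg k ⊕ 𝟙 x) x ≡ chg k₁ x
        charge-x = begin
          chg k x xor 𝟙 x x               ≡⟨ cong (chg k x xor_) (𝟙-self x) ⟩
          chg k x xor true                ≡⟨ cong (chg k x xor_) (Inc⇒incidence G x~e) ⟨
          γ false x xor incidence G e x   ≡⟨ γ-flip false x ⟨
          γ true x                        ≡⟨ proj₂ L x (here x∈S) ⟨
          chg k₁ x                        ∎
          where open ≡-Reasoning
        chi-x : Chi G (sub k₁) (chg k₁) α′ x
        chi-x = subst (ParityL G (sub k₁) α′ x (allFin m)) charge-x
                  (ParityL-edges G (λ f → ⇔.trans (proj₂ S≈Cx f) (⇔.sym (proj₂ (proj₁ L) f))) (sat′ x x∈S))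

    ¬¬a∈S : ¬ ¬ vert S a
    ¬¬a∈S = ¬¬-map (λ e∈S → proj₁ (closed S e e∈S)) ¬¬e∈S

    ¬¬b∈S : ¬ ¬ vert S b
    ¬¬b∈S = ¬¬-map (λ e∈S → proj₂ (closed S e e∈S)) ¬¬e∈S

    toggle-a→b : ∀ ℓ → Walk G (minusEdge G S e) a b → Unsat G (Comp a) (γ ℓ) → Unsat G (Comp a) (γ (not ℓ))
    toggle-a→b ℓ W unsat =
      unsat-cong G {Comp a} (λ v _ → sym (γ-flip ℓ v))
                 (unsat-toggle G (walk→comp G S e (here (walk-head∈ G W)) W) unsat)

    -- On the side of e away from x, γ true = γ false ⊕ 1_y, so the parity argument applies.
    not-both-unsat : ∀ {x y} → Joins G e x y → vert S y → ¬ vert (Comp y) x →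
                     Unsat G (Comp y) (γ false) → ¬ Unsat G (Comp y) (γ true)
    not-both-unsat {y = y} x~y y∈S x∉ unsat₀ unsat₁ =
      unsat-flip G (comp-connected G S e y) (here y∈S) unsat₀ (unsat-cong G {Comp y} (γ-away false x~y x∉) unsat₁)

    data Shape : Set where
      non-bridge : ¬ ¬ Walk G (minusEdge G S e) a b → (∀ ℓ → LandsIn ℓ a) → Shape
      bridge     : (side : Bool → Fin n) → Joins G e (side false) (side true) →
                   ¬ Walk G (minusEdge G S e) (side false) (side true) → (∀ ℓ → LandsIn ℓ (side ℓ)) → Shape

    shape : Shape
    shape with tag false | tag true
    ... | inj₁ (unsat₀ , L₀) | inj₁ (unsat₁ , L₁) = non-bridge ¬¬walk λ { false → L₀ ; true → L₁ }
      where
      ¬¬walk : ¬ ¬ Walk G (minusEdge G S e) a b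
      ¬¬walk no-walk = ¬¬a∈S λ a∈S → not-both-unsat (inj₂ (refl , refl)) a∈S no-walk unsat₀ unsat₁
    ... | inj₁ (unsat₀ , L₀) | inj₂ (sat₁ , L₁) =
      bridge (λ ℓ → if ℓ then b else a) (inj₁ (refl , refl))
             (λ W → sat₁ (toggle-a→b false W unsat₀))
             λ { false → L₀ ; true → L₁ }
    ... | inj₂ (sat₀ , L₀) | inj₁ (unsat₁ , L₁) =
      bridge (λ ℓ → if ℓ then a else b) (inj₂ (refl , refl))
             (λ W → sat₀ (toggle-a→b true (reverseʷ G W) unsat₁))
             λ { false → L₀ ; true → L₁ }
    ... | inj₂ (sat₀ , L₀) | inj₂ (sat₁ , L₁) = ⊥-elim (¬¬b∈S λ b∈S → ¬¬-excluded-middle λ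
      { (yes W)    → sat₀ (unsat-transport G {Comp b} {Comp a} (comp-cong G S e (reverseʷ G W)) (λ _ _ → refl)
                                          (unsat-landing L₀))
      ; (no no-walk) → not-both-unsat (inj₁ (refl , refl)) b∈S (no-walk ∘ reverseʷ G)
                                      (unsat-landing L₀) (unsat-landing L₁) })

    split-at : ∀ {x y} → edge S e → Joins G e x y → vert S x → ∀ w α →
               SatAt k w α ⇔ (¬ ¬ Satisfies G (Comp x) (γ (α e) ⊕ 𝟙 w) α ×
                              ¬ ¬ Satisfies G (Comp y) (γ (α e) ⊕ 𝟙 w) α)
    split-at {x} {y} e∈S x~y x∈S w α =
      ⇔.trans (¬¬sat⇔comps G (conn k) e∈S x~y x∈S) (regauge x ×-⇔ regauge y)
      where
      regauge : ∀ z → (¬ ¬ Satisfies G (Comp z) (gamma G (chg k ⊕ 𝟙 w) e (α e)) α) ⇔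
                      (¬ ¬ Satisfies G (Comp z) (γ (α e) ⊕ 𝟙 w) α)
      regauge z = ¬¬sat-transport G (same-refl G {Comp z}) (λ v _ → gamma-⊕ G (chg k) (𝟙 w) e (α e) v)

    landing⇔ : ∀ {ℓ x} → LandsIn ℓ x → ∀ w α →
               SatAt (next ℓ) w α ⇔ (¬ ¬ Satisfies G (Comp x) (γ ℓ ⊕ 𝟙 w) α)
    landing⇔ {ℓ} {x} (S≈ , ag) w α =
      ¬¬sat-transport G {sub (next ℓ)} {Comp x} S≈ (λ v v∈ → cong (_xor 𝟙 w v) (ag v v∈))

    non-bridge-split : edge S e → Walk G (minusEdge G S e) a b → (∀ ℓ → LandsIn ℓ a) →
                       ∀ w α → SatAt k w α ⇔ SatAt (next (α e)) w α
    non-bridge-split e∈S W L w α =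
      ⇔.trans (split-at e∈S (inj₁ (refl , refl)) (walk-head∈ G W) w α)
              (⇔.trans collapse (⇔.sym (landing⇔ (L (α e)) w α)))
      where
      collapse : (¬ ¬ Satisfies G (Comp a) (γ (α e) ⊕ 𝟙 w) α × ¬ ¬ Satisfies G (Comp b) (γ (α e) ⊕ 𝟙 w) α)
                 ⇔ (¬ ¬ Satisfies G (Comp a) (γ (α e) ⊕ 𝟙 w) α)
      collapse = mk⇔ proj₁ λ ¬¬sat →
        ¬¬sat , Equivalence.to (¬¬sat-transport G (comp-cong G S e W) (λ _ _ → refl)) ¬¬sat

    module Bridge (side : Bool → Fin n) (joins : Joins G e (side false) (side true))
                  (apart : ¬ Walk G (minusEdge G S e) (side false) (side true))
                  (lands : ∀ ℓ → LandsIn ℓ (side ℓ)) where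

      oriented : ∀ ℓ → Joins G e (side ℓ) (side (not ℓ))
      oriented false = joins
      oriented true  = Joins-sym G joins

      separated : ∀ ℓ → ¬ Walk G (minusEdge G S e) (side ℓ) (side (not ℓ))
      separated false = apart
      separated true  = apart ∘ reverseʷ G

      -- The selected side is unsatisfiable with γ ℓ alone, so it absorbs 1_w; the other side then
      -- carries γ ℓ, which is its own successor's charge shifted at its end of e.
      bridge-split : edge S e → ∀ w α →
                     SatAt k w α ⇔ (SatAt (next (α e)) w α × SatAt (next (not (α e))) (side (not (α e))) α)
      bridge-split e∈S w α =
        ⇔.trans (split-at e∈S (oriented ℓ) (Joins-left∈ G {S} e∈S (oriented ℓ)) w α)
                (×-⇔-dep (⇔.sym (landing⇔ (lands ℓ) w α)) partner)
        where
        ℓ = α e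
        x = side ℓ
        y = side (not ℓ)
        partner : ¬ ¬ Satisfies G (Comp x) (γ ℓ ⊕ 𝟙 w) α →
                  (¬ ¬ Satisfies G (Comp y) (γ ℓ ⊕ 𝟙 w) α) ⇔ SatAt (next (not ℓ)) y α
        partner ¬¬satX =
          ⇔.trans (¬¬sat-drop-flip G {Comp y} {Comp x} (λ v P Q → separated ℓ (comp-meet G S e Q P))
                                     (unsat-landing (lands ℓ)) ¬¬satX)
                  (⇔.sym (⇔.trans (landing⇔ (lands (not ℓ)) y α) regauge))
          where
          regauge : (¬ ¬ Satisfies G (Comp y) (γ (not ℓ) ⊕ 𝟙 y) α) ⇔ (¬ ¬ Satisfies G (Comp y) (γ ℓ) α)
          regauge = ¬¬sat-transport G (same-refl G {Comp y}) λ v v∈ →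
            trans (cong (_xor 𝟙 y v) (γ-away ℓ (oriented ℓ) (separated ℓ ∘ reverseʷ G) v v∈))
                  (xor-cancelʳ (γ ℓ v) (𝟙 y v))

      edges-apart : ∀ ℓ f → edge (sub (next ℓ)) f → edge (sub (next (not ℓ))) f → ⊥
      edges-apart ℓ f p q = comp-edges-disjoint G S e (separated ℓ)
        (Equivalence.to (proj₂ (proj₁ (lands ℓ)) f) p) (Equivalence.to (proj₂ (proj₁ (lands (not ℓ))) f) q)

    PartnerSat : Bool → Maybe (Fin n) → Assignment G → Set
    PartnerSat ℓ nothing  α = ⊤
    PartnerSat ℓ (just y) α = SatAt (next ℓ) y α

    record Splitting : Set where
      field
        partner : Bool → Maybe (Fin n)
        split   : ∀ w α → SatAt k w α ⇔ (SatAt (next (α e)) w α × PartnerSat (not (α e)) (partner (α e)) α)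
        apart   : ∀ ℓ {y} → partner ℓ ≡ just y →
                  ∀ f → edge (sub (next ℓ)) f → edge (sub (next (not ℓ))) f → ⊥

    splitting : Splitting
    splitting with shape
    ... | non-bridge ¬¬W lands = record
      { partner = λ _ → nothing
      ; split   = λ w α → ¬¬-⇔ negated-stable (stable-× negated-stable λ _ → _)
                    (do e∈S ← ¬¬e∈S ; W ← ¬¬W ; pure (e∈S , W))
                    λ (e∈S , W) → ⇔.trans (non-bridge-split e∈S W lands w α) (mk⇔ (_, _) proj₁)
      ; apart   = λ _ () }
    ... | bridge side joins apart lands = record
      { partner = λ ℓ → just (side (not ℓ))
      ; split   = λ w α → ¬¬-⇔ negated-stable (stable-× negated-stable negated-stable) ¬¬e∈S
                    λ e∈S → bridge-split e∈S w α
      ; apart   = λ ℓ _ → edges-apart ℓ }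
      where open Bridge side joins apart lands

    next-later : ∀ ℓ → k < next ℓ
    next-later false = proj₁ (ordered B k e k₀ k₁ node≡)
    next-later true  = proj₂ (ordered B k e k₀ k₁ node≡)

    decision-step : ∀ w {g} (C : Circuit m g) → Decomposable C → (env : Fin (suc s) → Fin n → Wire m g) →
                    (∀ ℓ w′ → Spec (next ℓ) w′ C (env (next ℓ) w′)) → Extension C 5 (Spec k w)
    decision-step w {g} C dC env env-ok = record
      { extended = combined ; extends = extends ; decomposable = decomposable dC pq-apart e∉p e∉q
      ; bounded = ≤-refl ; wire = out ; realises = semantics , variables }
      where
      open Splitting splitting
      partner-wire : Bool → Maybe (Fin n) → Wire m g
      partner-wire ℓ nothing  = const true
      partner-wire ℓ (just y) = env (next ℓ) y
      p q : Bool → Wire m g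
      p ℓ = env (next ℓ) w
      q ℓ = partner-wire (not ℓ) (partner ℓ)
      open Gadget C e p q
      partner-sem : ∀ ℓ mz α → (evalW C α (partner-wire ℓ mz) ≡ true) ⇔ PartnerSat ℓ mz α
      partner-sem ℓ nothing  α = mk⇔ _ (λ _ → refl)
      partner-sem ℓ (just y) α = proj₁ (env-ok ℓ y) α
      partner-vars : ∀ ℓ mz {y} → VarsW C (partner-wire ℓ mz) y →
                     ∃ λ z → mz ≡ just z × ¬ ¬ edge (sub (next ℓ)) y
      partner-vars ℓ (just z) v = z , refl , proj₂ (env-ok ℓ z) _ v
      p-vars : ∀ ℓ {y} → VarsW C (p ℓ) y → ¬ ¬ edge (sub (next ℓ)) y
      p-vars ℓ = proj₂ (env-ok ℓ w) _
      semantics : ∀ α → (evalW combined α out ≡ true) ⇔ SatAt k w α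
      semantics α =
        ⇔.trans (≡-true⇔ (eval-out α))
        (⇔.trans ∧-true⇔
        (⇔.trans (proj₁ (env-ok (α e) w) α ×-⇔ partner-sem (not (α e)) (partner (α e)) α)
                 (⇔.sym (split w α))))
      variables : ∀ y → VarsW combined out y → ¬ ¬ edge S y
      variables y v with vars-out v
      ... | inj₁ refl          = ¬¬e∈S
      ... | inj₂ (ℓ , inj₁ P) = ¬¬-map (proj₁ ∘ next-edge⊆ ℓ) (p-vars ℓ P)
      ... | inj₂ (ℓ , inj₂ Q) =
        ¬¬-map (proj₁ ∘ next-edge⊆ (not ℓ)) (proj₂ (proj₂ (partner-vars (not ℓ) (partner ℓ) Q)))
      pq-apart : ∀ ℓ → Disjoint C (p ℓ) (q ℓ)
      pq-apart ℓ y P Q with partner-vars (not ℓ) (partner ℓ) Q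
      ... | _ , partner≡ , ¬¬y∈ = p-vars ℓ P λ y∈ → ¬¬y∈ λ y∈′ → apart ℓ partner≡ y y∈ y∈′
      e∉p : ∀ ℓ → ¬ VarsW C (p ℓ) e
      e∉p ℓ P = p-vars ℓ P λ e∈ → proj₂ (next-edge⊆ ℓ e∈) refl
      e∉q : ∀ ℓ → ¬ VarsW C (q ℓ) e
      e∉q ℓ Q =
        proj₂ (proj₂ (partner-vars (not ℓ) (partner ℓ) Q)) λ e∈ → proj₂ (next-edge⊆ (not ℓ) e∈) refl

  node-step : ∀ k w {g} (C : Circuit m g) → Decomposable C → (env : Fin (suc s) → Fin n → Wire m g) →
              (∀ j → k < j → ∀ w′ → Spec j w′ C (env j w′)) → Extension C 5 (Spec k w)
  node-step k w C dC env env-ok with node B k in node≡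
  ... | sink v = record
    { extended = C ; extends = ≼-refl ; decomposable = dC ; bounded = m≤n+m _ 5 ; wire = const (𝟙 w v)
    ; realises = (λ α → ⇔.sym (sink-sat⇔ node≡ w α)) , λ _ () }
  ... | dec e k₀ k₁ = decision-step w C dC env λ ℓ → env-ok (next ℓ) (next-later ℓ)
    where open DecisionNode node≡


root-vertex : ∀ {n m} (G : Graph n m) {c} → Connected G (fullSub G) → Unsat G (fullSub G) c →
              ∃ λ w → Satisfiable G (fullSub G) (c ⊕ 𝟙 w)
root-vertex G conn unsat with sat-up-to-one-vertex G {fullSub G} (λ _ → yes _) (λ _ → yes _) conn _
... | inj₁ sat              = ⊥-elim (unsat sat)
... | inj₂ (w , _ , sat)    = w , sat

size-bound : ∀ s n → suc s * (n * 5) ≡ 5 * suc s * n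
size-bound s n = begin
  suc s * (n * 5)   ≡⟨ cong (suc s *_) (*-comm n 5) ⟩
  suc s * (5 * n)   ≡⟨ *-assoc (suc s) 5 n ⟨
  suc s * 5 * n     ≡⟨ cong (_* n) (*-comm (suc s) 5) ⟩
  5 * suc s * n     ∎
  where open ≡-Reasoning

lemma4 : Σ ℕ λ K →
    ∀ {n m s : ℕ} (G : Graph n m) → Connected G (fullSub G) →
    (c* c : Charge G) → Satisfiable G (fullSub G) c* → Unsat G (fullSub G) c →
    (B : BP n m (suc s)) → ReadOnce B → WellStructured G B c zero →
    Σ (DNNF m) λ D → size D ≤ K * suc s * n × ComputesT D G c*
lemma4 = 5 , λ {n} {m} {s} G conn c* c (α* , sat*) unsat B _ ws →
  let open WellStructuredBP G B ws
      open Build Spec spec-weaken 5 node-step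
      open Built build
      w₀ , β , satβ = root-vertex G conn unsat
      t = α* ⊕ β
      D = record { size = gates ; circuit = shiftᶜ t built ; output = shiftʷ t (wires zero w₀)
                 ; decomp = decomposable-shift t built decomposable }
  in D , ≤-trans bounded (≤-reflexive (size-bound s n)) , λ α →
       ⇔.trans (≡-true⇔ (eval-shift t built α (wires zero w₀)))
       (⇔.trans (proj₁ (realised zero w₀ _) (α ⊕ t))
       (⇔.trans (source-sat⇔ w₀ (α ⊕ t))
                (⇔.sym (Parity.sat-translate G {fullSub G} (λ _ → yes _) sat* satβ))))
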